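{- For every positive integer $n$, any complete generalized Zeckendorf game on $n$ in which only combining moves are performed has fewer than $0.7757\,n$ moves.
   Context: Let $a_1=1$, $a_2=2$ and $a_{i+1}=i\,a_i+a_{i-1}$ for $i\ge 2$. The generalized Zeckendorf game on $n$: the state is a multiset of terms of the sequence, initially $n$ copies of $a_1=1$. A move is one of: (combining) replace two $1$'s by one $2$; or, for $i\ge 2$, if the multiset contains at least $i$ copies of $a_i$ and at least one $a_{i-1}$, replace $i$ copies of $a_i$ and one $a_{i-1}$ by one $a_{i+1}$; (splitting) if it contains three $2$'s, replace them by one $1$ and one $5$; or, for $i\ge 3$, if it contains $i+1$ copies of $a_i$, replace them by one $a_{i+1}$, $i-2$ copies of $a_{i-1}$ and one $a_{i-2}$. The game ends when no move is available. A complete game is a sequence of legal moves from the initial state to a state with no available move. -}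

module Defs where

open import Data.Nat using (ℕ; zero; suc; _+_; _*_; _∸_; _≤_; _≡ᵇ_)
open import Data.Bool using (if_then_else_)
open import Data.Empty using (⊥)
open import Data.Unit using (⊤)
open import Data.Product using (_×_)
open import Data.List using (List; []; _∷_)
open import Relation.Nullary using (¬_)

-- The sequence a₁ = 1, a₂ = 2, a_{i+1} = i·a_i + a_{i-1} (i ≥ 2).
-- (a 0 is an unused dummy value.)  The terms are strictly increasing,
-- hence pairwise distinct, so a multiset of terms is the same as a
-- count for each index i ≥ 1.
a : ℕ → ℕ
a zero = 0
a (suc zero) = 1
a (suc (suc zero)) = 2
a (suc (suc (suc k))) = suc (suc k) * a (suc (suc k)) + a (suc k)

-- A game state: s i = number of copies of a_i in the multiset (index 0 unused).
State : Set
State = ℕ → ℕ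

initial : ℕ → State
initial n (suc zero) = n
initial n _ = 0

addAt : ℕ → ℕ → State → State
addAt j c s k = if k ≡ᵇ j then s k + c else s k

subAt : ℕ → ℕ → State → State
subAt j c s k = if k ≡ᵇ j then s k ∸ c else s k

-- Moves, labelled by the index i they act on.
--   combine 1      : two a₁ ↦ one a₂
--   combine i, i≥2 : i copies of a_i and one a_{i-1} ↦ one a_{i+1}
--   split 2        : three a₂ ↦ one a₁ and one a₃ (= 5)
--   split i, i≥3   : i+1 copies of a_i ↦ one a_{i+1}, i-2 copies of a_{i-1}, one a_{i-2}
data Move : Set where
  combine : ℕ → Move
  split   : ℕ → Move

Legal : Move → State → Set
Legal (combine zero) s = ⊥
Legal (combine (suc zero)) s = 2 ≤ s 1
Legal (combine (suc (suc k))) s = suc (suc k) ≤ s (suc (suc k)) × 1 ≤ s (suc k)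
Legal (split zero) s = ⊥
Legal (split (suc zero)) s = ⊥
Legal (split (suc (suc zero))) s = 3 ≤ s 2
Legal (split (suc (suc (suc k)))) s = suc (suc (suc (suc k))) ≤ s (suc (suc (suc k)))

apply : Move → State → State
apply (combine zero) s = s
apply (combine (suc zero)) s = addAt 2 1 (subAt 1 2 s)
apply (combine (suc (suc k))) s =
  addAt (suc (suc (suc k))) 1 (subAt (suc k) 1 (subAt (suc (suc k)) (suc (suc k)) s))
apply (split zero) s = s
apply (split (suc zero)) s = s
apply (split (suc (suc zero))) s = addAt 3 1 (addAt 1 1 (subAt 2 3 s))
apply (split (suc (suc (suc k)))) s =
  addAt (suc k) 1 (addAt (suc (suc k)) (suc k)
    (addAt (suc (suc (suc (suc k)))) 1 (subAt (suc (suc (suc k))) (suc (suc (suc (suc k)))) s)))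

Terminal : State → Set
Terminal s = ∀ m → ¬ Legal m s

data CompleteGame : State → List Move → Set where
  done : ∀ {s} → Terminal s → CompleteGame s []
  step : ∀ {s m ms} → Legal m s → CompleteGame (apply m s) ms → CompleteGame s (m ∷ ms)

IsCombining : Move → Set
IsCombining (combine _) = ⊤
IsCombining (split _) = ⊥

{-# OPTIONS --safe #-}
-- Weigh a copy of a_i by c_i, where (scaled by 10000) c₁ = 7757, c₂ = 2c₁ − 10000 and
-- c_{i+1} = i·c_i + c_{i-1} − 10000.  These weights are chosen so that every combining
-- move lowers the potential Σ c_i·s_i by exactly 10000, while the value Σ a_i·s_i = n is
-- preserved.  All c_i are positive, so the potential of the final (nonempty) state is
-- positive; it starts at 7757·n, which bounds the number of moves.
module Submission where

open import Defs
open import Data.Nat using (ℕ; zero; suc; _+_; _*_; _∸_; _<_; _≤_; _≡ᵇ_; z≤n; s≤s)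
open import Data.Nat.Properties
open import Data.Bool using (true; false; T)
open import Data.Unit using (tt)
open import Data.List using (List; []; _∷_; length)
open import Data.List.Relation.Unary.All using (All; _∷_)
open import Data.Product using (_,_)
open import Data.Sum using (inj₁; inj₂)
open import Relation.Nullary using (yes; no; contradiction)
open import Relation.Binary.PropositionalEquality
open import Data.Nat.Tactic.RingSolver using (solve-∀)
open import Algebra.Properties.CommutativeSemigroup +-commutativeSemigroup using (xy∙z≈xz∙y)

open ≤-Reasoning

private
  variable
    j k N : ℕ
    s u : State

≡ᵇ-refl : ∀ j → (j ≡ᵇ j) ≡ true
≡ᵇ-refl zero    = refl
≡ᵇ-refl (suc j) = ≡ᵇ-refl j

≢⇒≡ᵇ-false : ∀ k j → k ≢ j → (k ≡ᵇ j) ≡ false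
≢⇒≡ᵇ-false k j k≢j with k ≡ᵇ j in eq
... | true  = contradiction (≡ᵇ⇒≡ k j (subst T (sym eq) tt)) k≢j
... | false = refl

addAt-≡ : ∀ j d s → addAt j d s j ≡ s j + d
addAt-≡ j d s rewrite ≡ᵇ-refl j = refl

addAt-≢ : ∀ j d s → k ≢ j → addAt j d s k ≡ s k
addAt-≢ {k} j d s k≢j rewrite ≢⇒≡ᵇ-false k j k≢j = refl

subAt-≡ : ∀ j d s → subAt j d s j ≡ s j ∸ d
subAt-≡ j d s rewrite ≡ᵇ-refl j = refl

subAt-≢ : ∀ j d s → k ≢ j → subAt j d s k ≡ s k
subAt-≢ {k} j d s k≢j rewrite ≢⇒≡ᵇ-false k j k≢j = refl

weightedSum : (ℕ → ℕ) → ℕ → State → ℕ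
weightedSum f zero    s = 0
weightedSum f (suc N) s = weightedSum f N s + f N * s N

weightedSum-cong : ∀ f N → (∀ k → k < N → s k ≡ u k) → weightedSum f N s ≡ weightedSum f N u
weightedSum-cong f zero    s≗u = refl
weightedSum-cong f (suc N) s≗u =
  cong₂ _+_ (weightedSum-cong f N (λ k k<N → s≗u k (m<n⇒m<1+n k<N)))
            (cong (f N *_) (s≗u N ≤-refl))

weightedSum-addAt : ∀ f N j d s → j < N →
  weightedSum f N (addAt j d s) ≡ weightedSum f N s + f j * d
weightedSum-addAt f (suc N) j d s j<1+N with m<1+n⇒m<n∨m≡n j<1+N
... | inj₂ refl = begin-equality
  weightedSum f j (addAt j d s) + f j * addAt j d s j
    ≡⟨ cong₂ _+_ (weightedSum-cong f j (λ k k<j → addAt-≢ j d s (<⇒≢ k<j)))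
                 (cong (f j *_) (addAt-≡ j d s)) ⟩
  weightedSum f j s + f j * (s j + d)
    ≡⟨ cong (weightedSum f j s +_) (*-distribˡ-+ (f j) (s j) d) ⟩
  weightedSum f j s + (f j * s j + f j * d)
    ≡⟨ +-assoc (weightedSum f j s) _ _ ⟨
  weightedSum f j s + f j * s j + f j * d ∎
... | inj₁ j<N = begin-equality
  weightedSum f N (addAt j d s) + f N * addAt j d s N
    ≡⟨ cong₂ _+_ (weightedSum-addAt f N j d s j<N) (cong (f N *_) (addAt-≢ j d s (>⇒≢ j<N))) ⟩
  weightedSum f N s + f j * d + f N * s N
    ≡⟨ xy∙z≈xz∙y (weightedSum f N s) _ _ ⟩
  weightedSum f N s + f N * s N + f j * d ∎

addAt-subAt : ∀ j d s → d ≤ s j → ∀ k → addAt j d (subAt j d s) k ≡ s k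
addAt-subAt j d s d≤sj k with k ≟ j
... | yes refl = begin-equality
  addAt k d (subAt k d s) k ≡⟨ addAt-≡ k d (subAt k d s) ⟩
  subAt k d s k + d         ≡⟨ cong (_+ d) (subAt-≡ k d s) ⟩
  s k ∸ d + d               ≡⟨ m∸n+n≡m d≤sj ⟩
  s k                       ∎
... | no  k≢j  = trans (addAt-≢ j d (subAt j d s) k≢j) (subAt-≢ j d s k≢j)

weightedSum-subAt : ∀ f N j d s → j < N → d ≤ s j →
  weightedSum f N (subAt j d s) + f j * d ≡ weightedSum f N s
weightedSum-subAt f N j d s j<N d≤sj = begin-equality
  weightedSum f N (subAt j d s) + f j * d   ≡⟨ weightedSum-addAt f N j d _ j<N ⟨
  weightedSum f N (addAt j d (subAt j d s)) ≡⟨ weightedSum-cong f N (λ k _ → addAt-subAt j d s d≤sj k) ⟩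
  weightedSum f N s                         ∎

weightedSum-initial : ∀ f N n → 1 < N → weightedSum f N (initial n) ≡ f 1 * n
weightedSum-initial f (suc zero)          n (s≤s ())
weightedSum-initial f (suc (suc zero))    n _ = cong (_+ f 1 * n) (*-zeroʳ (f 0))
weightedSum-initial f (suc (suc (suc N))) n _ = begin-equality
  weightedSum f (suc (suc N)) (initial n) + f (suc (suc N)) * 0
    ≡⟨ cong₂ _+_ (weightedSum-initial f (suc (suc N)) n (s≤s (s≤s z≤n))) (*-zeroʳ (f (suc (suc N)))) ⟩
  f 1 * n + 0
    ≡⟨ +-identityʳ _ ⟩
  f 1 * n ∎

weightedSum-≡0 : ∀ f g N s → (∀ k → g k ≡ 0 → f k ≡ 0) →
  weightedSum g N s ≡ 0 → weightedSum f N s ≡ 0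
weightedSum-≡0 f g zero    s g0⇒f0 _ = refl
weightedSum-≡0 f g (suc N) s g0⇒f0 sum≡0
  rewrite weightedSum-≡0 f g N s g0⇒f0 (m+n≡0⇒m≡0 _ sum≡0)
  with m*n≡0⇒m≡0∨n≡0 (g N) (m+n≡0⇒n≡0 (weightedSum g N s) sum≡0)
... | inj₁ gN≡0 rewrite g0⇒f0 N gN≡0 = refl
... | inj₂ sN≡0 rewrite sN≡0 = *-zeroʳ (f N)

VanishesFrom : ℕ → State → Set
VanishesFrom N s = ∀ k → N ≤ k → s k ≡ 0

vanishesFrom-support : VanishesFrom N s → 0 < s j → j < N
vanishesFrom-support {N} {s} {j} vanish 0<sj with j <? N
... | yes j<N = j<N
... | no  j≮N = contradiction (vanish j (≮⇒≥ j≮N)) (>⇒≢ 0<sj)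

vanishesFrom-subAt : ∀ j d → VanishesFrom N s → VanishesFrom N (subAt j d s)
vanishesFrom-subAt {s = s} j d vanish k N≤k with k ≟ j
... | yes refl = trans (subAt-≡ k d s) (trans (cong (_∸ d) (vanish k N≤k)) (0∸n≡0 d))
... | no  k≢j  = trans (subAt-≢ j d s k≢j) (vanish k N≤k)

vanishesFrom-addAt : ∀ j d → j < N → VanishesFrom N s → VanishesFrom N (addAt j d s)
vanishesFrom-addAt {s = s} j d j<N vanish k N≤k =
  trans (addAt-≢ j d s (λ { refl → <⇒≱ j<N N≤k })) (vanish k N≤k)

inputWeight : (ℕ → ℕ) → ℕ → ℕ
inputWeight f zero          = 0
inputWeight f (suc zero)    = 2 * f 1
inputWeight f (suc (suc k)) = suc (suc k) * f (suc (suc k)) + f (suc k)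

takeInputs : ℕ → State → State
takeInputs zero          s = s
takeInputs (suc zero)    s = subAt 1 2 s
takeInputs (suc (suc k)) s = subAt (suc k) 1 (subAt (suc (suc k)) (suc (suc k)) s)

apply-combine : ∀ i s → apply (combine (suc i)) s ≡ addAt (suc (suc i)) 1 (takeInputs (suc i) s)
apply-combine zero    s = refl
apply-combine (suc i) s = refl

legal-combine⇒present : ∀ i → Legal (combine i) s → 0 < s i
legal-combine⇒present (suc zero)    2≤s₁        = ≤-trans (s≤s z≤n) 2≤s₁
legal-combine⇒present (suc (suc k)) (k+2≤s , _) = ≤-trans (s≤s z≤n) k+2≤s

weightedSum-takeInputs : ∀ f N i s → Legal (combine i) s → i < N →
  weightedSum f N (takeInputs i s) + inputWeight f i ≡ weightedSum f N s
weightedSum-takeInputs f N (suc zero) s 2≤s₁ 1<N =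
  trans (cong (weightedSum f N (subAt 1 2 s) +_) (*-comm 2 (f 1)))
        (weightedSum-subAt f N 1 2 s 1<N 2≤s₁)
weightedSum-takeInputs f N (suc (suc k)) s (k+2≤s , 1≤s) k+2<N = begin-equality
  weightedSum f N (subAt (suc k) 1 t) + (suc (suc k) * f (suc (suc k)) + f (suc k))
    ≡⟨ rearrange (weightedSum f N (subAt (suc k) 1 t)) (suc (suc k)) (f (suc (suc k))) (f (suc k)) ⟩
  weightedSum f N (subAt (suc k) 1 t) + f (suc k) * 1 + f (suc (suc k)) * suc (suc k)
    ≡⟨ cong (_+ _) (weightedSum-subAt f N (suc k) 1 t (<-trans (n<1+n _) k+2<N) 1≤t) ⟩
  weightedSum f N t + f (suc (suc k)) * suc (suc k)
    ≡⟨ weightedSum-subAt f N (suc (suc k)) (suc (suc k)) s k+2<N k+2≤s ⟩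
  weightedSum f N s ∎
  where
  t : State
  t = subAt (suc (suc k)) (suc (suc k)) s
  1≤t : 1 ≤ t (suc k)
  1≤t = subst (1 ≤_) (sym (subAt-≢ (suc (suc k)) (suc (suc k)) s (≢-sym 1+n≢n))) 1≤s
  rearrange : ∀ A x y z → A + (x * y + z) ≡ A + z * 1 + y * x
  rearrange = solve-∀

weightedSum-combine : ∀ f δ N i s → inputWeight f (suc i) ≡ f (suc (suc i)) + δ →
  Legal (combine (suc i)) s → suc (suc i) < N →
  weightedSum f N (apply (combine (suc i)) s) + δ ≡ weightedSum f N s
weightedSum-combine f δ N i s inputWeight≡ legal i+2<N = begin-equality
  weightedSum f N (apply (combine (suc i)) s) + δ
    ≡⟨ cong (λ s′ → weightedSum f N s′ + δ) (apply-combine i s) ⟩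
  weightedSum f N (addAt (suc (suc i)) 1 t) + δ
    ≡⟨ cong (_+ δ) (weightedSum-addAt f N (suc (suc i)) 1 t i+2<N) ⟩
  weightedSum f N t + f (suc (suc i)) * 1 + δ
    ≡⟨ cong (λ x → weightedSum f N t + x + δ) (*-identityʳ _) ⟩
  weightedSum f N t + f (suc (suc i)) + δ
    ≡⟨ +-assoc (weightedSum f N t) _ _ ⟩
  weightedSum f N t + (f (suc (suc i)) + δ)
    ≡⟨ cong (weightedSum f N t +_) inputWeight≡ ⟨
  weightedSum f N t + inputWeight f (suc i)
    ≡⟨ weightedSum-takeInputs f N (suc i) s legal (<-trans (n<1+n _) i+2<N) ⟩
  weightedSum f N s ∎
  where
  t : State
  t = takeInputs (suc i) s

vanishesFrom-combine : ∀ i → suc (suc i) < N → VanishesFrom N s →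
  VanishesFrom N (apply (combine (suc i)) s)
vanishesFrom-combine zero    3<N vanish =
  vanishesFrom-addAt 2 1 3<N (vanishesFrom-subAt 1 2 vanish)
vanishesFrom-combine (suc k) k+4<N vanish =
  vanishesFrom-addAt (suc (suc (suc k))) 1 k+4<N
    (vanishesFrom-subAt (suc k) 1 (vanishesFrom-subAt (suc (suc k)) (suc (suc k)) vanish))

n≤a : ∀ n → n ≤ a n
n≤a zero                = z≤n
n≤a (suc zero)          = ≤-refl
n≤a (suc (suc zero))    = ≤-refl
n≤a (suc (suc (suc k))) = begin
  suc (suc (suc k))                       ≡⟨ +-comm 1 (suc (suc k)) ⟩
  suc (suc k) + 1                         ≤⟨ +-mono-≤ (n≤a (suc (suc k))) (≤-trans (s≤s z≤n) (n≤a (suc k))) ⟩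
  a (suc (suc k)) + a (suc k)             ≤⟨ +-monoˡ-≤ _ (m≤n*m (a (suc (suc k))) (suc (suc k))) ⟩
  suc (suc k) * a (suc (suc k)) + a (suc k) ∎

inputWeight-a : ∀ i → inputWeight a (suc i) ≡ a (suc (suc i)) + 0
inputWeight-a zero    = refl
inputWeight-a (suc i) = sym (+-identityʳ _)

c : ℕ → ℕ
c zero                = 0
c (suc zero)          = 7757
c (suc (suc zero))    = 5514
c (suc (suc (suc k))) = suc (suc k) * c (suc (suc k)) + c (suc k) ∸ 10000

5000≤c : ∀ k → 5000 ≤ c (suc k)
5000≤c zero          = m≤m+n 5000 2757
5000≤c (suc zero)    = m≤m+n 5000 514
5000≤c (suc (suc k)) = ∸-monoˡ-≤ 10000
  (+-mono-≤ (*-mono-≤ {2} {suc (suc k)} (s≤s (s≤s z≤n)) (5000≤c (suc k))) (5000≤c k))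

inputWeight-c : ∀ i → inputWeight c (suc i) ≡ c (suc (suc i)) + 10000
inputWeight-c zero    = refl
inputWeight-c (suc k) = sym (m∸n+n≡m
  (≤-trans (*-mono-≤ {2} {suc (suc k)} (s≤s (s≤s z≤n)) (5000≤c (suc k))) (m≤m+n _ _)))

c≡0⇒a≡0 : ∀ k → c k ≡ 0 → a k ≡ 0
c≡0⇒a≡0 zero    _   = refl
c≡0⇒a≡0 (suc k) c≡0 = contradiction (subst (5000 ≤_) c≡0 (5000≤c k)) λ ()

-- The output a_{i+2} of the move is bounded by the value of the state.
combine-output-in-range : ∀ N s i → VanishesFrom N s → weightedSum a N s < N →
  Legal (combine (suc i)) s → suc (suc i) < N
combine-output-in-range N s i vanish value<N legal = begin-strict
  suc (suc i)                                        ≤⟨ n≤a (suc (suc i)) ⟩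
  a (suc (suc i))                                    ≡⟨ +-identityʳ _ ⟨
  a (suc (suc i)) + 0                                ≡⟨ inputWeight-a i ⟨
  inputWeight a (suc i)                              ≤⟨ m≤n+m _ _ ⟩
  weightedSum a N (takeInputs (suc i) s) + inputWeight a (suc i)
    ≡⟨ weightedSum-takeInputs a N (suc i) s legal
         (vanishesFrom-support vanish (legal-combine⇒present (suc i) legal)) ⟩
  weightedSum a N s                                  <⟨ value<N ⟩
  N                                                  ∎

combiningGame-bound : ∀ w δ → (∀ i → inputWeight w (suc i) ≡ w (suc (suc i)) + δ) →
  (∀ k → w k ≡ 0 → a k ≡ 0) →
  ∀ N s ms → VanishesFrom N s → weightedSum a N s < N → 0 < weightedSum a N s →
  CompleteGame s ms → All IsCombining ms → δ * length ms < weightedSum w N s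
combiningGame-bound w δ inputWeight-w w≡0⇒a≡0 N s [] _ _ 0<value _ _ rewrite *-zeroʳ δ =
  n≢0⇒n>0 (λ potential≡0 → >⇒≢ 0<value (weightedSum-≡0 a w N s w≡0⇒a≡0 potential≡0))
combiningGame-bound w δ inputWeight-w w≡0⇒a≡0 N s (combine zero ∷ ms) _ _ _ (step () _) _
combiningGame-bound w δ inputWeight-w w≡0⇒a≡0 N s (combine (suc i) ∷ ms) vanish value<N 0<value
  (step legal game) (_ ∷ combining) = begin-strict
  δ * suc (length ms)      ≡⟨ *-suc δ (length ms) ⟩
  δ + δ * length ms        <⟨ +-monoʳ-< δ bound′ ⟩
  δ + weightedSum w N s′   ≡⟨ +-comm δ _ ⟩
  weightedSum w N s′ + δ   ≡⟨ weightedSum-combine w δ N i s (inputWeight-w i) legal i+2<N ⟩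
  weightedSum w N s        ∎
  where
  s′ : State
  s′ = apply (combine (suc i)) s
  i+2<N : suc (suc i) < N
  i+2<N = combine-output-in-range N s i vanish value<N legal
  value≡ : weightedSum a N s′ ≡ weightedSum a N s
  value≡ = trans (sym (+-identityʳ _)) (weightedSum-combine a 0 N i s (inputWeight-a i) legal i+2<N)
  bound′ : δ * length ms < weightedSum w N s′
  bound′ = combiningGame-bound w δ inputWeight-w w≡0⇒a≡0 N s′ ms (vanishesFrom-combine i i+2<N vanish)
    (subst (_< N) (sym value≡) value<N) (subst (0 <_) (sym value≡) 0<value) game combining
combiningGame-bound w δ inputWeight-w w≡0⇒a≡0 N s (split _ ∷ ms) _ _ _ _ (() ∷ _)

theorem6p7 : (n : ℕ) → 1 ≤ n → (ms : List Move) → CompleteGame (initial n) ms →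
    All IsCombining ms → 10000 * length ms < 7757 * n
theorem6p7 n 1≤n ms game combining =
  subst (10000 * length ms <_) (weightedSum-initial c (suc n) n (s≤s 1≤n))
    (combiningGame-bound c 10000 inputWeight-c c≡0⇒a≡0 (suc n) (initial n) ms vanish
      (subst (_< suc n) (sym value≡n) (n<1+n n)) (subst (0 <_) (sym value≡n) 1≤n)
      game combining)
  where
  vanish : VanishesFrom (suc n) (initial n)
  vanish zero          _         = refl
  vanish (suc zero)    (s≤s n≤0) = contradiction n≤0 (<⇒≱ 1≤n)
  vanish (suc (suc k)) _         = refl
  value≡n : weightedSum a (suc n) (initial n) ≡ n
  value≡n = trans (weightedSum-initial a (suc n) n (s≤s 1≤n)) (*-identityˡ n)
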